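{- Let $R\cong F_1\times F_2\times\cdots\times F_n$ with $n\ge 2$, where each $F_i$ is a field. Then: (i) If $F_i\cong\mathbb{Z}_2$ for all $1\le i\le n$, then $\mathrm{sdim}(\mathrm{Cl}_2(R))=2^n-2$. (ii) If each $F_i$ is isomorphic to $\mathbb{Z}_2$ or $\mathbb{Z}_3$ and $R\not\cong\mathbb{Z}_2\times\cdots\times\mathbb{Z}_2$, then $\mathrm{sdim}(\mathrm{Cl}_2(R))=(2^n-1)\prod_{i=1}^n(|F_i|-1)-2^n+1$.
   Context: $U(R)$ is the set of units and $\mathrm{Id}(R)$ the set of idempotents of the commutative ring $R$. The clean graph $\mathrm{Cl}(R)$ has vertex set $\{(e,u): e\in\mathrm{Id}(R), u\in U(R)\}$, two distinct vertices $(e,u),(f,v)$ being adjacent iff $ef=0$ or $uv=1$; $\mathrm{Cl}_2(R)$ is its subgraph induced by the vertices with $e\neq 0$. In a graph, a vertex $w$ strongly resolves vertices $x,y$ if some shortest $x$–$w$ path contains $y$ or some shortest $y$–$w$ path contains $x$; a strong resolving set is a set $S$ of vertices such that every two distinct vertices are strongly resolved by some vertex of $S$; $\mathrm{sdim}$ is the smallest cardinality of a strong resolving set. -}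

module Defs where

open import Data.Nat using (ℕ; zero; suc; _*_; _≤_)
open import Data.Nat.DivMod using (_mod_)
open import Data.Fin using (Fin; toℕ) renaming (zero to fz; suc to fs)
open import Data.Unit using (⊤; tt)
open import Data.Product using (Σ; ∃; _×_; _,_)
open import Data.Sum using (_⊎_)
open import Data.List using (List; []; _∷_; length)
open import Data.List.Membership.Propositional using (_∈_)
open import Data.List.Relation.Unary.All using (All)
open import Data.List.Relation.Unary.Any using (Any)
open import Data.List.Relation.Unary.Unique.Propositional using (Unique)
open import Relation.Nullary using (¬_)
open import Relation.Binary.PropositionalEquality using (_≡_)

-- A graph is given by a carrier type V, a vertex-membership predicate
-- InG and an adjacency relation Adj (which already requires both ends
-- to be vertices of the graph).

module GraphNotions {V : Set} (InG : V → Set) (Adj : V → V → Set) where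

  -- walks x → z ; shortest walks are exactly the shortest paths
  data Walk : V → V → Set where
    here : ∀ {x} → InG x → Walk x x
    step : ∀ {x y z} → Adj x y → Walk y z → Walk x z

  len : ∀ {x z} → Walk x z → ℕ
  len (here _) = 0
  len (step _ p) = suc (len p)

  verts : ∀ {x z} → Walk x z → List V
  verts {x} (here _) = x ∷ []
  verts {x} (step _ p) = x ∷ verts p

  Shortest : ∀ {x z} → Walk x z → Set
  Shortest {x} {z} p = (q : Walk x z) → len p ≤ len q

  OnShortest : V → V → V → Set
  OnShortest x w y = Σ (Walk x w) λ p → Shortest p × (y ∈ verts p)

  StronglyResolves : V → V → V → Set
  StronglyResolves w x y = OnShortest x w y ⊎ OnShortest y w x

  StrongResolvingSet : List V → Set
  StrongResolvingSet S =
    All InG S ×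
    (∀ x y → InG x → InG y → ¬ (x ≡ y) →
      Σ V λ w → (w ∈ S) × StronglyResolves w x y)

  IsSdim : ℕ → Set
  IsSdim k =
    (Σ (List V) λ S → StrongResolvingSet S × Unique S × length S ≡ k) ×
    (∀ S → StrongResolvingSet S → k ≤ length S)

data Fld : Set where
  ℤ₂ ℤ₃ : Fld

card : Fld → ℕ
card ℤ₂ = 2
card ℤ₃ = 3

El : Fld → Set
El F = Fin (card F)

mulF : (F : Fld) → El F → El F → El F
mulF ℤ₂ a b = (toℕ a * toℕ b) mod 2
mulF ℤ₃ a b = (toℕ a * toℕ b) mod 3

zeroF oneF : (F : Fld) → El F
zeroF ℤ₂ = fz
zeroF ℤ₃ = fz
oneF ℤ₂ = fs fz
oneF ℤ₃ = fs fz

Ring : List Fld → Set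
Ring [] = ⊤
Ring (F ∷ Fs) = El F × Ring Fs

mulR : (Fs : List Fld) → Ring Fs → Ring Fs → Ring Fs
mulR [] _ _ = tt
mulR (F ∷ Fs) (a , x) (b , y) = mulF F a b , mulR Fs x y

zeroR oneR : (Fs : List Fld) → Ring Fs
zeroR [] = tt
zeroR (F ∷ Fs) = zeroF F , zeroR Fs
oneR [] = tt
oneR (F ∷ Fs) = oneF F , oneR Fs

IsIdempotent : (Fs : List Fld) → Ring Fs → Set
IsIdempotent Fs e = mulR Fs e e ≡ e

IsUnit : (Fs : List Fld) → Ring Fs → Set
IsUnit Fs u = Σ (Ring Fs) λ v → mulR Fs u v ≡ oneR Fs

Cl₂Vertex : (Fs : List Fld) → Ring Fs × Ring Fs → Set
Cl₂Vertex Fs (e , u) = IsIdempotent Fs e × ¬ (e ≡ zeroR Fs) × IsUnit Fs u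

Cl₂Adj : (Fs : List Fld) → Ring Fs × Ring Fs → Ring Fs × Ring Fs → Set
Cl₂Adj Fs (e , u) (f , v) =
  Cl₂Vertex Fs (e , u) × Cl₂Vertex Fs (f , v) × ¬ ((e , u) ≡ (f , v)) ×
  (mulR Fs e f ≡ zeroR Fs ⊎ mulR Fs u v ≡ oneR Fs)

SdimCl₂ : (Fs : List Fld) → ℕ → Set
SdimCl₂ Fs k = GraphNotions.IsSdim (Cl₂Vertex Fs) (Cl₂Adj Fs) k

module Submission where

-- Units of ℤ₂ and ℤ₃ are involutions, so distinct vertices (e , u), (f , v) of Cl₂(R) are adjacent
-- iff ef = 0 or u = v, and any two vertices are joined by a path of length at most 3: through the
-- complement 1 - e of an idempotent, or through a proper idempotent when e = f = 1.
-- A strong resolving set contains one of any two mutually maximally distant vertices. If R = ℤ₂ⁿ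
-- the only unit is 1 and Cl₂(R) is the complete graph on the 2ⁿ - 1 vertices (e , 1), so
-- sdim = 2ⁿ - 2. Otherwise each block {e} × U(R), e ≠ 0, consists of pairwise mutually maximally
-- distant vertices, which forces (2ⁿ - 1)(|U(R)| - 1) vertices into every strong resolving set.
-- The vertices (e , u) with u ≠ 1 attain this: a vertex resolves every pair containing it, and
-- (e , 1), (f , 1) are resolved by (g , v), v ≠ 1, for an idempotent g with eg = 0 ≠ fg.

open import Defs
open import Data.Empty using (⊥-elim)
open import Data.Fin using () renaming (zero to fz; suc to fs)
import Data.Fin.Properties as Fin
open import Data.List using (List; []; _∷_; _++_; length; map; filter; cartesianProduct)
open import Data.List.Properties
  using (length-++; length-map; filter-++; filter-all; filter-accept; filter-reject; filter-notAll)
open import Data.List.Membership.Propositional using (_∈_)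
open import Data.List.Membership.Propositional.Properties
  using (∈-length; ∈-map⁺; ∈-map⁻; ∈-filter⁺; ∈-filter⁻; ∈-cartesianProduct⁺; ∈-cartesianProduct⁻)
import Data.List.Membership.DecPropositional as DecMembership
open import Data.List.Relation.Unary.All using (All; []; _∷_)
import Data.List.Relation.Unary.All as All
open import Data.List.Relation.Unary.AllPairs using ([]; _∷_)
open import Data.List.Relation.Unary.Any using (Any; here; there)
import Data.List.Relation.Unary.Any as Any
open import Data.List.Relation.Unary.Unique.Propositional using (Unique)
import Data.List.Relation.Unary.Unique.Propositional.Properties as Unique
open import Data.Nat using (ℕ; suc; z≤n; s≤s; _≤_; _<_; _+_; _*_; _∸_; _^_)
open import Data.Nat.ListAction using (product)
open import Data.Nat.Properties
  using (≤-refl; ≤-trans; ≤-reflexive; <⇒≱; +-mono-≤; *-mono-≤; +-suc; +-comm; *-suc; m≤n+m∸n; m∸n+n≡m;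
         [m+n]∸[m+o]≡n∸o; module ≤-Reasoning)
open import Data.Product using (Σ; ∃; _×_; _,_; proj₁; proj₂)
import Data.Product as Product
open import Data.Product.Properties using (,-injectiveˡ; ,-injectiveʳ; ≡-dec)
open import Data.Sum using (_⊎_; inj₁; inj₂)
import Data.Sum as Sum
open import Data.Unit using (tt)
import Data.Unit.Properties as Unit
open import Function using (_∘_)
open import Relation.Nullary using (¬_; Dec; yes; no; ¬?)
open import Relation.Nullary.Decidable using (_⊎-dec_; _×-dec_)
open import Relation.Unary using (Decidable)
open import Relation.Binary.Definitions using (DecidableEquality)
open import Relation.Binary.PropositionalEquality
  using (_≡_; _≢_; refl; sym; trans; cong; cong₂; subst; module ≡-Reasoning)

mulF-comm : ∀ F (a b : El F) → mulF F a b ≡ mulF F b a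
mulF-comm ℤ₂ fz      fz      = refl
mulF-comm ℤ₂ fz      (fs fz) = refl
mulF-comm ℤ₂ (fs fz) fz      = refl
mulF-comm ℤ₂ (fs fz) (fs fz) = refl
mulF-comm ℤ₃ fz           fz           = refl
mulF-comm ℤ₃ fz           (fs fz)      = refl
mulF-comm ℤ₃ fz           (fs (fs fz)) = refl
mulF-comm ℤ₃ (fs fz)      fz           = refl
mulF-comm ℤ₃ (fs fz)      (fs fz)      = refl
mulF-comm ℤ₃ (fs fz)      (fs (fs fz)) = refl
mulF-comm ℤ₃ (fs (fs fz)) fz           = refl
mulF-comm ℤ₃ (fs (fs fz)) (fs fz)      = refl
mulF-comm ℤ₃ (fs (fs fz)) (fs (fs fz)) = refl

mulF-zeroʳ : ∀ F (a : El F) → mulF F a (zeroF F) ≡ zeroF F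
mulF-zeroʳ ℤ₂ fz           = refl
mulF-zeroʳ ℤ₂ (fs fz)      = refl
mulF-zeroʳ ℤ₃ fz           = refl
mulF-zeroʳ ℤ₃ (fs fz)      = refl
mulF-zeroʳ ℤ₃ (fs (fs fz)) = refl

mulF-identityˡ : ∀ F (a : El F) → mulF F (oneF F) a ≡ a
mulF-identityˡ ℤ₂ fz           = refl
mulF-identityˡ ℤ₂ (fs fz)      = refl
mulF-identityˡ ℤ₃ fz           = refl
mulF-identityˡ ℤ₃ (fs fz)      = refl
mulF-identityˡ ℤ₃ (fs (fs fz)) = refl

zeroF≢oneF : ∀ F → zeroF F ≢ oneF F
zeroF≢oneF ℤ₂ ()
zeroF≢oneF ℤ₃ ()

idempotentF : ∀ F {a} → mulF F a a ≡ a → a ≡ zeroF F ⊎ a ≡ oneF F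
idempotentF ℤ₂ {fz}           _ = inj₁ refl
idempotentF ℤ₂ {fs fz}        _ = inj₂ refl
idempotentF ℤ₃ {fz}           _ = inj₁ refl
idempotentF ℤ₃ {fs fz}        _ = inj₂ refl
idempotentF ℤ₃ {fs (fs fz)} ()

mulF≡oneF⇒≡ : ∀ F {a b} → mulF F a b ≡ oneF F → a ≡ b
mulF≡oneF⇒≡ ℤ₂ {fz} ()
mulF≡oneF⇒≡ ℤ₂ {fs fz} {fz} ()
mulF≡oneF⇒≡ ℤ₂ {fs fz} {fs fz} _ = refl
mulF≡oneF⇒≡ ℤ₃ {fz} ()
mulF≡oneF⇒≡ ℤ₃ {fs fz} {fz} ()
mulF≡oneF⇒≡ ℤ₃ {fs fz} {fs fz} _ = refl
mulF≡oneF⇒≡ ℤ₃ {fs fz} {fs (fs fz)} ()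
mulF≡oneF⇒≡ ℤ₃ {fs (fs fz)} {fz} ()
mulF≡oneF⇒≡ ℤ₃ {fs (fs fz)} {fs fz} ()
mulF≡oneF⇒≡ ℤ₃ {fs (fs fz)} {fs (fs fz)} _ = refl

-- 1 - a on the idempotents 0 and 1; the value at 2 ∈ ℤ₃ is junk.
complementF : ∀ F → El F → El F
complementF ℤ₂ fz     = fs fz
complementF ℤ₂ (fs _) = fz
complementF ℤ₃ fz     = fs fz
complementF ℤ₃ (fs _) = fz

complementF-idempotent : ∀ F a → mulF F (complementF F a) (complementF F a) ≡ complementF F a
complementF-idempotent ℤ₂ fz     = refl
complementF-idempotent ℤ₂ (fs _) = refl
complementF-idempotent ℤ₃ fz     = refl
complementF-idempotent ℤ₃ (fs _) = refl

mulF-complementʳ : ∀ F {a} → mulF F a a ≡ a → mulF F a (complementF F a) ≡ zeroF F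
mulF-complementʳ ℤ₂ {fz}      _ = refl
mulF-complementʳ ℤ₂ {fs fz}   _ = refl
mulF-complementʳ ℤ₃ {fz}      _ = refl
mulF-complementʳ ℤ₃ {fs fz}   _ = refl
mulF-complementʳ ℤ₃ {fs (fs fz)} ()

complementF≡zeroF⇒≡oneF : ∀ F {a} → mulF F a a ≡ a → complementF F a ≡ zeroF F → a ≡ oneF F
complementF≡zeroF⇒≡oneF ℤ₂ {fs fz} _ _ = refl
complementF≡zeroF⇒≡oneF ℤ₃ {fs fz} _ _ = refl
complementF≡zeroF⇒≡oneF ℤ₃ {fs (fs fz)} () _

complementF≡oneF⇒≡zeroF : ∀ F {a} → complementF F a ≡ oneF F → a ≡ zeroF F
complementF≡oneF⇒≡zeroF ℤ₂ {fz} _ = refl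
complementF≡oneF⇒≡zeroF ℤ₃ {fz} _ = refl

idempotentsF : ∀ F → List (El F)
idempotentsF F = zeroF F ∷ oneF F ∷ []

unitsF : ∀ F → List (El F)
unitsF ℤ₂ = fs fz ∷ []
unitsF ℤ₃ = fs fz ∷ fs (fs fz) ∷ []

Unique-idempotentsF : ∀ F → Unique (idempotentsF F)
Unique-idempotentsF F = (zeroF≢oneF F ∷ []) ∷ [] ∷ []

Unique-unitsF : ∀ F → Unique (unitsF F)
Unique-unitsF ℤ₂ = [] ∷ []
Unique-unitsF ℤ₃ = ((λ ()) ∷ []) ∷ [] ∷ []

length-unitsF : ∀ F → length (unitsF F) ≡ card F ∸ 1
length-unitsF ℤ₂ = refl
length-unitsF ℤ₃ = refl

∈-idempotentsF⁺ : ∀ F {a} → mulF F a a ≡ a → a ∈ idempotentsF F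
∈-idempotentsF⁺ F i with idempotentF F i
... | inj₁ refl = here refl
... | inj₂ refl = there (here refl)

∈-idempotentsF⁻ : ∀ F {a} → a ∈ idempotentsF F → mulF F a a ≡ a
∈-idempotentsF⁻ F (here refl)         = mulF-zeroʳ F (zeroF F)
∈-idempotentsF⁻ F (there (here refl)) = mulF-identityˡ F (oneF F)

∈-unitsF⁺ : ∀ F {a b} → mulF F a b ≡ oneF F → a ∈ unitsF F
∈-unitsF⁺ ℤ₂ {fs fz}      _ = here refl
∈-unitsF⁺ ℤ₃ {fs fz}      _ = here refl
∈-unitsF⁺ ℤ₃ {fs (fs fz)} _ = there (here refl)
∈-unitsF⁺ ℤ₂ {fz} ()
∈-unitsF⁺ ℤ₃ {fz} ()

∈-unitsF⁻ : ∀ F {a} → a ∈ unitsF F → mulF F a a ≡ oneF F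
∈-unitsF⁻ ℤ₂ (here refl)         = refl
∈-unitsF⁻ ℤ₃ (here refl)         = refl
∈-unitsF⁻ ℤ₃ (there (here refl)) = refl

≟-Ring : ∀ Fs → DecidableEquality (Ring Fs)
≟-Ring []       = Unit._≟_
≟-Ring (F ∷ Fs) = ≡-dec Fin._≟_ (≟-Ring Fs)

mulR-comm : ∀ Fs (x y : Ring Fs) → mulR Fs x y ≡ mulR Fs y x
mulR-comm []       _       _       = refl
mulR-comm (F ∷ Fs) (a , x) (b , y) = cong₂ _,_ (mulF-comm F a b) (mulR-comm Fs x y)

mulR-zeroʳ : ∀ Fs (x : Ring Fs) → mulR Fs x (zeroR Fs) ≡ zeroR Fs
mulR-zeroʳ []       _       = refl
mulR-zeroʳ (F ∷ Fs) (a , x) = cong₂ _,_ (mulF-zeroʳ F a) (mulR-zeroʳ Fs x)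

mulR-identityˡ : ∀ Fs (x : Ring Fs) → mulR Fs (oneR Fs) x ≡ x
mulR-identityˡ []       _       = refl
mulR-identityˡ (F ∷ Fs) (a , x) = cong₂ _,_ (mulF-identityˡ F a) (mulR-identityˡ Fs x)

mulR≡oneR⇒≡ : ∀ Fs {x y} → mulR Fs x y ≡ oneR Fs → x ≡ y
mulR≡oneR⇒≡ []       _     = refl
mulR≡oneR⇒≡ (F ∷ Fs) xy≡1 =
  cong₂ _,_ (mulF≡oneF⇒≡ F (,-injectiveˡ xy≡1)) (mulR≡oneR⇒≡ Fs (,-injectiveʳ xy≡1))

unit-square : ∀ Fs {u} → IsUnit Fs u → mulR Fs u u ≡ oneR Fs
unit-square Fs (_ , uv≡1) with refl ← mulR≡oneR⇒≡ Fs uv≡1 = uv≡1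

complement : ∀ Fs → Ring Fs → Ring Fs
complement []       _       = tt
complement (F ∷ Fs) (a , x) = complementF F a , complement Fs x

complement-idempotent : ∀ Fs e → IsIdempotent Fs (complement Fs e)
complement-idempotent []       _       = refl
complement-idempotent (F ∷ Fs) (a , e) = cong₂ _,_ (complementF-idempotent F a) (complement-idempotent Fs e)

mulR-complementʳ : ∀ Fs {e} → IsIdempotent Fs e → mulR Fs e (complement Fs e) ≡ zeroR Fs
mulR-complementʳ []       _  = refl
mulR-complementʳ (F ∷ Fs) ie =
  cong₂ _,_ (mulF-complementʳ F (,-injectiveˡ ie)) (mulR-complementʳ Fs (,-injectiveʳ ie))

complement≡zeroR⇒≡oneR : ∀ Fs {e} → IsIdempotent Fs e → complement Fs e ≡ zeroR Fs → e ≡ oneR Fs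
complement≡zeroR⇒≡oneR []       _  _  = refl
complement≡zeroR⇒≡oneR (F ∷ Fs) ie ē≡0 =
  cong₂ _,_ (complementF≡zeroF⇒≡oneF F (,-injectiveˡ ie) (,-injectiveˡ ē≡0))
            (complement≡zeroR⇒≡oneR Fs (,-injectiveʳ ie) (,-injectiveʳ ē≡0))

complement≡oneR⇒≡zeroR : ∀ Fs {e} → complement Fs e ≡ oneR Fs → e ≡ zeroR Fs
complement≡oneR⇒≡zeroR []       _    = refl
complement≡oneR⇒≡zeroR (F ∷ Fs) ē≡1 =
  cong₂ _,_ (complementF≡oneF⇒≡zeroF F (,-injectiveˡ ē≡1))
            (complement≡oneR⇒≡zeroR Fs (,-injectiveʳ ē≡1))

Separates : ∀ Fs → Ring Fs → Ring Fs → Ring Fs → Set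
Separates Fs e f g = IsIdempotent Fs g × g ≢ zeroR Fs × mulR Fs e g ≡ zeroR Fs × mulR Fs f g ≢ zeroR Fs

separates-by-head : ∀ F Fs (e f : Ring Fs) →
                    Separates (F ∷ Fs) (zeroF F , e) (oneF F , f) (oneF F , zeroR Fs)
separates-by-head F Fs e f =
  cong₂ _,_ (mulF-identityˡ F (oneF F)) (mulR-zeroʳ Fs (zeroR Fs)) ,
  zeroF≢oneF F ∘ sym ∘ ,-injectiveˡ ,
  cong₂ _,_ (trans (mulF-comm F (zeroF F) (oneF F)) (mulF-zeroʳ F (oneF F))) (mulR-zeroʳ Fs e) ,
  λ fg≡0 → zeroF≢oneF F (trans (sym (,-injectiveˡ fg≡0)) (mulF-identityˡ F (oneF F)))

separates-by-tail : ∀ F Fs {e f g} (a b : El F) →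
                    Separates Fs e f g → Separates (F ∷ Fs) (a , e) (b , f) (zeroF F , g)
separates-by-tail F Fs a b (ig , g≢0 , eg≡0 , fg≢0) =
  cong₂ _,_ (mulF-zeroʳ F (zeroF F)) ig , g≢0 ∘ ,-injectiveʳ ,
  cong₂ _,_ (mulF-zeroʳ F a) eg≡0 , fg≢0 ∘ ,-injectiveʳ

separate : ∀ Fs {e f} → IsIdempotent Fs e → IsIdempotent Fs f → e ≢ f →
           ∃ (Separates Fs e f) ⊎ ∃ (Separates Fs f e)
separate []       _  _  e≢f = ⊥-elim (e≢f refl)
separate (F ∷ Fs) {a , e} {b , f} ie if ae≢bf with a Fin.≟ b
... | yes refl = Sum.map extend extend
                         (separate Fs (,-injectiveʳ ie) (,-injectiveʳ if) (ae≢bf ∘ cong (a ,_)))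
  where
  extend : ∀ {e f} → ∃ (Separates Fs e f) → ∃ (Separates (F ∷ Fs) (a , e) (a , f))
  extend = Product.map (zeroF F ,_) (separates-by-tail F Fs a a)
... | no a≢b with idempotentF F (,-injectiveˡ ie) | idempotentF F (,-injectiveˡ if)
...   | inj₁ refl | inj₂ refl = inj₁ (_ , separates-by-head F Fs e f)
...   | inj₂ refl | inj₁ refl = inj₂ (_ , separates-by-head F Fs f e)
...   | inj₁ refl | inj₁ refl = ⊥-elim (a≢b refl)
...   | inj₂ refl | inj₂ refl = ⊥-elim (a≢b refl)

length-cartesianProduct : ∀ {A B : Set} (xs : List A) (ys : List B) →
                          length (cartesianProduct xs ys) ≡ length xs * length ys
length-cartesianProduct []       ys = refl
length-cartesianProduct (x ∷ xs) ys = begin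
    length (map (x ,_) ys ++ cartesianProduct xs ys)
  ≡⟨ length-++ (map (x ,_) ys) ⟩
    length (map (x ,_) ys) + length (cartesianProduct xs ys)
  ≡⟨ cong₂ _+_ (length-map (x ,_) ys) (length-cartesianProduct xs ys) ⟩
    length ys + length xs * length ys
  ∎
  where open ≡-Reasoning

idempotents : ∀ Fs → List (Ring Fs)
idempotents []       = tt ∷ []
idempotents (F ∷ Fs) = cartesianProduct (idempotentsF F) (idempotents Fs)

units : ∀ Fs → List (Ring Fs)
units []       = tt ∷ []
units (F ∷ Fs) = cartesianProduct (unitsF F) (units Fs)

∈-idempotents⁺ : ∀ Fs {e} → IsIdempotent Fs e → e ∈ idempotents Fs
∈-idempotents⁺ []       _  = here refl
∈-idempotents⁺ (F ∷ Fs) ie =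
  ∈-cartesianProduct⁺ (∈-idempotentsF⁺ F (,-injectiveˡ ie)) (∈-idempotents⁺ Fs (,-injectiveʳ ie))

∈-idempotents⁻ : ∀ Fs {e} → e ∈ idempotents Fs → IsIdempotent Fs e
∈-idempotents⁻ []       _ = refl
∈-idempotents⁻ (F ∷ Fs) e∈ =
  let a∈ , e′∈ = ∈-cartesianProduct⁻ (idempotentsF F) (idempotents Fs) e∈
  in cong₂ _,_ (∈-idempotentsF⁻ F a∈) (∈-idempotents⁻ Fs e′∈)

∈-units⁺ : ∀ Fs {u} → IsUnit Fs u → u ∈ units Fs
∈-units⁺ []       _                  = here refl
∈-units⁺ (F ∷ Fs) ((_ , v) , uv≡1) =
  ∈-cartesianProduct⁺ (∈-unitsF⁺ F (,-injectiveˡ uv≡1)) (∈-units⁺ Fs (v , ,-injectiveʳ uv≡1))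

∈-units⁻ : ∀ Fs {u} → u ∈ units Fs → IsUnit Fs u
∈-units⁻ Fs {u} u∈ = u , self-inverse Fs u∈
  where
  self-inverse : ∀ Fs {u} → u ∈ units Fs → mulR Fs u u ≡ oneR Fs
  self-inverse []       _  = refl
  self-inverse (F ∷ Fs) u∈ =
    let a∈ , u′∈ = ∈-cartesianProduct⁻ (unitsF F) (units Fs) u∈
    in cong₂ _,_ (∈-unitsF⁻ F a∈) (self-inverse Fs u′∈)

Unique-idempotents : ∀ Fs → Unique (idempotents Fs)
Unique-idempotents []       = [] ∷ []
Unique-idempotents (F ∷ Fs) = Unique.cartesianProduct⁺ (Unique-idempotentsF F) (Unique-idempotents Fs)

Unique-units : ∀ Fs → Unique (units Fs)
Unique-units []       = [] ∷ []
Unique-units (F ∷ Fs) = Unique.cartesianProduct⁺ (Unique-unitsF F) (Unique-units Fs)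

length-idempotents : ∀ Fs → length (idempotents Fs) ≡ 2 ^ length Fs
length-idempotents []       = refl
length-idempotents (F ∷ Fs) =
  trans (length-cartesianProduct (idempotentsF F) (idempotents Fs)) (cong (2 *_) (length-idempotents Fs))

length-units : ∀ Fs → length (units Fs) ≡ product (map (λ F → card F ∸ 1) Fs)
length-units []       = refl
length-units (F ∷ Fs) =
  trans (length-cartesianProduct (unitsF F) (units Fs)) (cong₂ _*_ (length-unitsF F) (length-units Fs))

module _ {A : Set} (_≟_ : DecidableEquality A) where

  open DecMembership _≟_ using (_∈?_)

  without : A → List A → List A
  without x = filter (λ y → ¬? (y ≟ x))

  ∈-without⁺ : ∀ {x y xs} → y ∈ xs → y ≢ x → y ∈ without x xs
  ∈-without⁺ {x} = ∈-filter⁺ (λ y → ¬? (y ≟ x))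

  ∈-without⁻ : ∀ {x y} xs → y ∈ without x xs → y ∈ xs × y ≢ x
  ∈-without⁻ {x} xs = ∈-filter⁻ (λ y → ¬? (y ≟ x)) {xs = xs}

  Unique-without : ∀ {x xs} → Unique xs → Unique (without x xs)
  Unique-without {x} = Unique.filter⁺ (λ y → ¬? (y ≟ x))

  length-without : ∀ {x xs} → Unique xs → x ∈ xs → length xs ≡ suc (length (without x xs))
  length-without {x} {y ∷ ys} (y∉ys ∷ _) (here refl) = cong suc (sym (begin
      length (without y (y ∷ ys))
    ≡⟨ cong length (filter-reject (λ z → ¬? (z ≟ y)) (λ y≢y → y≢y refl)) ⟩
      length (without y ys)
    ≡⟨ cong length (filter-all (λ z → ¬? (z ≟ y)) (All.map (_∘ sym) y∉ys)) ⟩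
      length ys
    ∎))
    where open ≡-Reasoning
  length-without {x} {y ∷ ys} (y∉ys ∷ uys) (there x∈ys) = begin
      suc (length ys)
    ≡⟨ cong suc (length-without uys x∈ys) ⟩
      suc (length (y ∷ without x ys))
    ≡⟨ cong (suc ∘ length) (filter-accept (λ z → ¬? (z ≟ x)) (All.lookup y∉ys x∈ys)) ⟨
      suc (length (without x (y ∷ ys)))
    ∎
    where open ≡-Reasoning

  Unique-⊆⇒length≤ : ∀ {xs ys : List A} → Unique xs → (∀ {x} → x ∈ xs → x ∈ ys) →
                     length xs ≤ length ys
  Unique-⊆⇒length≤ {[]}     _            _      = z≤n
  Unique-⊆⇒length≤ {x ∷ xs} {ys} (x∉xs ∷ uxs) xxs⊆ys = begin-strict
      length xs
    ≤⟨ Unique-⊆⇒length≤ uxs (λ z∈xs → ∈-without⁺ (xxs⊆ys (there z∈xs)) (All.lookup x∉xs z∈xs ∘ sym)) ⟩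
      length (without x ys)
    <⟨ filter-notAll (λ z → ¬? (z ≟ x)) ys (Any.map (λ x≡z z≢x → z≢x (sym x≡z)) (xxs⊆ys (here refl))) ⟩
      length ys
    ∎
    where open ≤-Reasoning

  Unique⇒length-filter-∈≤ : ∀ {xs} ys → Unique xs → length (filter (_∈? ys) xs) ≤ length ys
  Unique⇒length-filter-∈≤ {xs} ys uxs =
    Unique-⊆⇒length≤ (Unique.filter⁺ (_∈? ys) uxs) (proj₂ ∘ ∈-filter⁻ (_∈? ys) {xs = xs})

module _ {A : Set} {P : A → Set} (P? : Decidable P) where

  cover⇒length∸1≤ : ∀ {xs} → Unique xs → (∀ {a b} → a ∈ xs → b ∈ xs → a ≢ b → P a ⊎ P b) →
                    length xs ∸ 1 ≤ length (filter P? xs)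
  cover⇒length∸1≤ {[]}     _ _ = z≤n
  cover⇒length∸1≤ {a ∷ xs} (a∉xs ∷ uxs) cover with P? a
  ... | yes _ = begin
      length xs
    ≤⟨ m≤n+m∸n (length xs) 1 ⟩
      suc (length xs ∸ 1)
    ≤⟨ s≤s (cover⇒length∸1≤ uxs (λ a∈ b∈ → cover (there a∈) (there b∈))) ⟩
      suc (length (filter P? xs))
    ∎
    where open ≤-Reasoning
  ... | no ¬pa = ≤-reflexive (cong length (sym (filter-all P? all-P)))
    where
    all-P : All P xs
    all-P = All.tabulate λ b∈ → Sum.[ ⊥-elim ∘ ¬pa , (λ pb → pb) ]′
                                      (cover (here refl) (there b∈) (All.lookup a∉xs b∈))

module _ {A B : Set} {P : A × B → Set} (P? : Decidable P) where

  length-filter-cartesianProduct≥ : ∀ xs ys {k} →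
                                    (∀ {x} → x ∈ xs → k ≤ length (filter P? (map (x ,_) ys))) →
                                    length xs * k ≤ length (filter P? (cartesianProduct xs ys))
  length-filter-cartesianProduct≥ []       ys _ = z≤n
  length-filter-cartesianProduct≥ (x ∷ xs) ys {k} rows = begin
      k + length xs * k
    ≤⟨ +-mono-≤ (rows (here refl)) (length-filter-cartesianProduct≥ xs ys (rows ∘ there)) ⟩
      length (filter P? row) + length (filter P? (cartesianProduct xs ys))
    ≡⟨ length-++ (filter P? row) ⟨
      length (filter P? row ++ filter P? (cartesianProduct xs ys))
    ≡⟨ cong length (filter-++ P? row (cartesianProduct xs ys)) ⟨
      length (filter P? (cartesianProduct (x ∷ xs) ys))
    ∎
    where
    open ≤-Reasoning
    row = map (x ,_) ys

module WalkProperties {V : Set} (InG : V → Set) (Adj : V → V → Set)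
                      (Adj⇒InG : ∀ {x y} → Adj x y → InG x × InG y) where

  open GraphNotions InG Adj public

  _++ʷ_ : ∀ {x y z} → Walk x y → Walk y z → Walk x z
  here _   ++ʷ q = q
  step a p ++ʷ q = step a (p ++ʷ q)

  len-++ʷ : ∀ {x y z} (p : Walk x y) (q : Walk y z) → len (p ++ʷ q) ≡ len p + len q
  len-++ʷ (here _)   q = refl
  len-++ʷ (step _ p) q = cong suc (len-++ʷ p q)

  split-at : ∀ {x y w} (p : Walk x w) → y ∈ verts p →
             Σ (Walk x y) λ p₁ → Σ (Walk y w) λ p₂ → len p₁ + len p₂ ≡ len p
  split-at (here ix)  (here refl) = here ix , here ix , refl
  split-at (step a p) (here refl) = here (proj₁ (Adj⇒InG a)) , step a p , refl
  split-at (step a p) (there y∈p) =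
    let p₁ , p₂ , p₁+p₂≡p = split-at p y∈p in step a p₁ , p₂ , cong suc p₁+p₂≡p

  end∈verts : ∀ {x y} (p : Walk x y) → y ∈ verts p
  end∈verts (here _)   = here refl
  end∈verts (step _ p) = there (end∈verts p)

  shortest⇒onShortest : ∀ {x y} (p : Walk x y) → Shortest p → OnShortest x y y
  shortest⇒onShortest p p-shortest = p , p-shortest , end∈verts p

  edgeWalk : ∀ {x y} → Adj x y → Walk x y
  edgeWalk a = step a (here (proj₂ (Adj⇒InG a)))

  1≤len : ∀ {x y} → x ≢ y → (q : Walk x y) → 1 ≤ len q
  1≤len x≢y (here _)   = ⊥-elim (x≢y refl)
  1≤len x≢y (step _ _) = s≤s z≤n

  2≤len : ∀ {x y} → x ≢ y → ¬ Adj x y → (q : Walk x y) → 2 ≤ len q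
  2≤len x≢y _    (here _)            = ⊥-elim (x≢y refl)
  2≤len _   ¬xy  (step a (here _))   = ⊥-elim (¬xy a)
  2≤len _   _    (step _ (step _ _)) = s≤s (s≤s z≤n)

  3≤len : ∀ {x y} → x ≢ y → ¬ Adj x y → (∀ {z} → Adj x z → ¬ Adj z y) →
          (q : Walk x y) → 3 ≤ len q
  3≤len x≢y _   _      (here _)                     = ⊥-elim (x≢y refl)
  3≤len _   ¬xy _      (step a (here _))            = ⊥-elim (¬xy a)
  3≤len _   _   no-mid (step a (step b (here _)))   = ⊥-elim (no-mid a b)
  3≤len _   _   _      (step _ (step _ (step _ _))) = s≤s (s≤s (s≤s z≤n))

  -- d is any lower bound for the distance from x to y, so this says that no neighbour of y is
  -- farther from x than y is.
  MaximallyDistant : V → V → Set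
  MaximallyDistant x y =
    Σ ℕ λ d → (∀ (q : Walk x y) → d ≤ len q) × (∀ {z} → Adj y z → Σ (Walk x z) λ q → len q ≤ d)

  MutuallyMaximallyDistant : V → V → Set
  MutuallyMaximallyDistant x y = MaximallyDistant x y × MaximallyDistant y x

  -- A shortest path through y that went on past y could be shortcut via a neighbour of y.
  maximallyDistant⇒onShortest⇒≡ : ∀ {x y w} → MaximallyDistant x y → OnShortest x w y → w ≡ y
  maximallyDistant⇒onShortest⇒≡ (d , far , near) (p , p-shortest , y∈p) with split-at p y∈p
  ... | _  , here _     , _         = refl
  ... | p₁ , step a p₂ , p₁+p₂≡p with near a
  ...   | q , q≤d = ⊥-elim (<⇒≱ shorter (p-shortest (q ++ʷ p₂)))
    where
    open ≤-Reasoning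
    shorter : len (q ++ʷ p₂) < len p
    shorter = begin
      suc (len (q ++ʷ p₂))  ≡⟨ cong suc (len-++ʷ q p₂) ⟩
      suc (len q + len p₂)  ≤⟨ s≤s (+-mono-≤ (≤-trans q≤d (far p₁)) ≤-refl) ⟩
      suc (len p₁ + len p₂) ≡⟨ +-suc (len p₁) (len p₂) ⟨
      len p₁ + suc (len p₂) ≡⟨ p₁+p₂≡p ⟩
      len p                 ∎

  mutuallyMaximallyDistant⇒∈ : ∀ {S x y} → StrongResolvingSet S → InG x → InG y → x ≢ y →
                               MutuallyMaximallyDistant x y → x ∈ S ⊎ y ∈ S
  mutuallyMaximallyDistant⇒∈ {S} (_ , resolve) ix iy x≢y (md-xy , md-yx) with resolve _ _ ix iy x≢y
  ... | w , w∈S , inj₁ y-on = inj₂ (subst (_∈ S) (maximallyDistant⇒onShortest⇒≡ md-xy y-on) w∈S)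
  ... | w , w∈S , inj₂ x-on = inj₁ (subst (_∈ S) (maximallyDistant⇒onShortest⇒≡ md-yx x-on) w∈S)

  module _ (_≟_ : DecidableEquality V) where

    open DecMembership _≟_ using (_∈?_)

    pairwise-mmd⇒length∸1≤ : ∀ {S xs} → StrongResolvingSet S → Unique xs → All InG xs →
                             (∀ {x y} → x ∈ xs → y ∈ xs → x ≢ y → MutuallyMaximallyDistant x y) →
                             length xs ∸ 1 ≤ length (filter (_∈? S) xs)
    pairwise-mmd⇒length∸1≤ {S} srs uxs ixs mmd = cover⇒length∸1≤ (_∈? S) uxs λ x∈ y∈ x≢y →
      mutuallyMaximallyDistant⇒∈ srs (All.lookup ixs x∈) (All.lookup ixs y∈) x≢y (mmd x∈ y∈ x≢y)

    complete⇒IsSdim : ∀ {vs v₀} → Unique vs → All InG vs → (∀ {x} → InG x → x ∈ vs) → v₀ ∈ vs →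
                      (∀ {x y} → InG x → InG y → x ≢ y → Adj x y) → IsSdim (length vs ∸ 1)
    complete⇒IsSdim {vs} {v₀} uvs ivs enumerates v₀∈ complete =
      (S , (All.tabulate (All.lookup ivs ∘ proj₁ ∘ ∈-without⁻ _≟_ vs) , resolve) , Unique-without _≟_ uvs ,
       cong (_∸ 1) (sym (length-without _≟_ uvs v₀∈))) ,
      λ S′ srs → ≤-trans (pairwise-mmd⇒length∸1≤ srs uvs ivs mmd)
                         (Unique⇒length-filter-∈≤ _≟_ S′ uvs)
      where
      S = without _≟_ v₀ vs
      onEdge : ∀ {x y} → InG x → InG y → x ≢ y → OnShortest x y y
      onEdge ix iy x≢y = shortest⇒onShortest (edgeWalk (complete ix iy x≢y)) (1≤len x≢y)
      resolve : ∀ x y → InG x → InG y → x ≢ y → Σ V λ w → w ∈ S × StronglyResolves w x y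
      resolve x y ix iy x≢y with x ≟ v₀
      ... | yes refl = y , ∈-without⁺ _≟_ (enumerates iy) (x≢y ∘ sym) , inj₁ (onEdge ix iy x≢y)
      ... | no x≢v₀  = x , ∈-without⁺ _≟_ (enumerates ix) x≢v₀ , inj₂ (onEdge iy ix (x≢y ∘ sym))
      md : ∀ {x y} → InG x → x ≢ y → MaximallyDistant x y
      md {x} ix x≢y = 1 , 1≤len x≢y , near
        where
        near : ∀ {z} → Adj _ z → Σ (Walk x z) λ q → len q ≤ 1
        near {z} a with x ≟ z
        ... | yes refl = here ix , z≤n
        ... | no x≢z   = edgeWalk (complete ix (proj₂ (Adj⇒InG a)) x≢z) , ≤-refl
      mmd : ∀ {x y} → x ∈ vs → y ∈ vs → x ≢ y → MutuallyMaximallyDistant x y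
      mmd x∈ y∈ x≢y = md (All.lookup ivs x∈) x≢y , md (All.lookup ivs y∈) (x≢y ∘ sym)

m*n≡m*[1+n]∸[1+m]+1 : ∀ m n → 1 ≤ m → 1 ≤ n → m * n ≡ m * suc n ∸ suc m + 1
m*n≡m*[1+n]∸[1+m]+1 m n 1≤m 1≤n = begin
  m * n                       ≡⟨ m∸n+n≡m (*-mono-≤ 1≤m 1≤n) ⟨
  m * n ∸ 1 + 1               ≡⟨ cong (_+ 1) ([m+n]∸[m+o]≡n∸o m (m * n) 1) ⟨
  m + m * n ∸ (m + 1) + 1     ≡⟨ cong₂ (λ a b → a ∸ b + 1) (*-suc m n) (+-comm 1 m) ⟨
  m * suc n ∸ suc m + 1       ∎
  where open ≡-Reasoning

oneR-isUnit : ∀ Fs → IsUnit Fs (oneR Fs)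
oneR-isUnit Fs = oneR Fs , mulR-identityˡ Fs (oneR Fs)

all-ℤ₂⇒unit≡oneR : ∀ Fs → All (_≡ ℤ₂) Fs → ∀ {u} → IsUnit Fs u → u ≡ oneR Fs
all-ℤ₂⇒unit≡oneR []       _              _                  = refl
all-ℤ₂⇒unit≡oneR (ℤ₂ ∷ Fs) (refl ∷ all-ℤ₂) {a , _} ((_ , v) , uv≡1)
  with here refl ← ∈-unitsF⁺ ℤ₂ {a} (,-injectiveˡ uv≡1)
  = cong (fs fz ,_) (all-ℤ₂⇒unit≡oneR Fs all-ℤ₂ (v , ,-injectiveʳ uv≡1))

nontrivialUnit : ∀ Fs → Any (_≡ ℤ₃) Fs → Σ (Ring Fs) λ v → IsUnit Fs v × v ≢ oneR Fs
nontrivialUnit (ℤ₃ ∷ Fs) (here refl) =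
  (fs (fs fz) , oneR Fs) ,
  ((fs (fs fz) , oneR Fs) , cong (fs fz ,_) (mulR-identityˡ Fs (oneR Fs))) ,
  (λ ()) ∘ ,-injectiveˡ
nontrivialUnit (F ∷ Fs) (there has-ℤ₃) =
  let v , (w , vw≡1) , v≢1 = nontrivialUnit Fs has-ℤ₃
  in (oneF F , v) , ((oneF F , w) , cong₂ _,_ (mulF-identityˡ F (oneF F)) vw≡1) , v≢1 ∘ ,-injectiveʳ

properIdempotent : ∀ F F′ Fs → Σ (Ring (F ∷ F′ ∷ Fs)) λ g →
                   IsIdempotent (F ∷ F′ ∷ Fs) g × g ≢ zeroR (F ∷ F′ ∷ Fs) × g ≢ oneR (F ∷ F′ ∷ Fs)
properIdempotent F F′ Fs =
  (oneF F , zeroR (F′ ∷ Fs)) ,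
  cong₂ _,_ (mulF-identityˡ F (oneF F)) (mulR-zeroʳ (F′ ∷ Fs) (zeroR (F′ ∷ Fs))) ,
  zeroF≢oneF F ∘ sym ∘ ,-injectiveˡ ,
  zeroF≢oneF F′ ∘ ,-injectiveˡ ∘ ,-injectiveʳ

module Cl₂Geometry (Fs : List Fld) where

  private
    infixl 7 _·_
    _·_ : Ring Fs → Ring Fs → Ring Fs
    _·_ = mulR Fs
    𝟘 𝟙 : Ring Fs
    𝟘 = zeroR Fs
    𝟙 = oneR Fs
    IsVertex = Cl₂Vertex Fs
    Adjacent = Cl₂Adj Fs

  Vertex : Set
  Vertex = Ring Fs × Ring Fs

  _≟ⱽ_ : DecidableEquality Vertex
  _≟ⱽ_ = ≡-dec (≟-Ring Fs) (≟-Ring Fs)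

  open WalkProperties IsVertex Adjacent (λ a → proj₁ a , proj₁ (proj₂ a)) public

  edge : ∀ {e u f v} → IsVertex (e , u) → IsVertex (f , v) → (e , u) ≢ (f , v) →
         e · f ≡ 𝟘 ⊎ u ≡ v → Adjacent (e , u) (f , v)
  edge ix iy x≢y (inj₁ ef≡0) = ix , iy , x≢y , inj₁ ef≡0
  edge ix iy x≢y (inj₂ refl) = ix , iy , x≢y , inj₂ (unit-square Fs (proj₂ (proj₂ ix)))

  edge⁻ : ∀ {e u f v} → Adjacent (e , u) (f , v) → e · f ≡ 𝟘 ⊎ u ≡ v
  edge⁻ (_ , _ , _ , inj₁ ef≡0) = inj₁ ef≡0
  edge⁻ (_ , _ , _ , inj₂ uv≡1) = inj₂ (mulR≡oneR⇒≡ Fs uv≡1)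

  edge? : ∀ e u f v → Dec (e · f ≡ 𝟘 ⊎ u ≡ v)
  edge? e u f v = ≟-Ring Fs (e · f) 𝟘 ⊎-dec ≟-Ring Fs u v

  adjacent-sym : ∀ {x y} → Adjacent x y → Adjacent y x
  adjacent-sym {e , _} {f , _} a@(ix , iy , x≢y , _) =
    edge iy ix (x≢y ∘ sym) (Sum.map (trans (mulR-comm Fs f e)) sym (edge⁻ a))

  neighbour-of-𝟙 : ∀ {u g w} → Adjacent (𝟙 , u) (g , w) → u ≡ w
  neighbour-of-𝟙 {g = g} a@(_ , (_ , g≢0 , _) , _) =
    Sum.[ ⊥-elim ∘ g≢0 ∘ trans (sym (mulR-identityˡ Fs g)) , (λ u≡w → u≡w) ]′ (edge⁻ a)

  square≢𝟘 : ∀ {e} → IsIdempotent Fs e → e ≢ 𝟘 → e · e ≢ 𝟘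
  square≢𝟘 ie e≢0 ee≡0 = e≢0 (trans (sym ie) ee≡0)

  ≢complement : ∀ {e f} → IsIdempotent Fs e → e · f ≢ 𝟘 → f ≢ complement Fs e
  ≢complement ie ef≢0 refl = ef≢0 (mulR-complementʳ Fs ie)

  complement-isVertex : ∀ {e v} → IsIdempotent Fs e → e ≢ 𝟙 → IsUnit Fs v → IsVertex (complement Fs e , v)
  complement-isVertex {e} ie e≢1 iv = complement-idempotent Fs e , e≢1 ∘ complement≡zeroR⇒≡oneR Fs ie , iv

  -- (e , u) — (complement e , v) — (f , v)
  walk-via-complementˡ : ∀ {e u f v} → IsVertex (e , u) → IsVertex (f , v) → e ≢ 𝟙 → e · f ≢ 𝟘 →
                         Walk (e , u) (f , v)
  walk-via-complementˡ ix@(ie , e≢0 , _) iy@(_ , _ , iv) e≢1 ef≢0 =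
    step (edge ix im (≢complement ie (square≢𝟘 ie e≢0) ∘ ,-injectiveˡ) (inj₁ (mulR-complementʳ Fs ie)))
         (step (edge im iy (≢complement ie ef≢0 ∘ sym ∘ ,-injectiveˡ) (inj₂ refl)) (here iy))
    where im = complement-isVertex ie e≢1 iv

  -- (e , u) — (complement f , u) — (f , v)
  walk-via-complementʳ : ∀ {e u f v} → IsVertex (e , u) → IsVertex (f , v) → f ≢ 𝟙 → e · f ≢ 𝟘 →
                         Walk (e , u) (f , v)
  walk-via-complementʳ {e} {f = f} ix@(_ , _ , iu) iy@(if , f≢0 , _) f≢1 ef≢0 =
    step (edge ix im (≢complement if (ef≢0 ∘ trans (mulR-comm Fs e f)) ∘ ,-injectiveˡ) (inj₂ refl))
         (step (edge im iy (≢complement if (square≢𝟘 if f≢0) ∘ sym ∘ ,-injectiveˡ)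
                           (inj₁ (trans (mulR-comm Fs _ f) (mulR-complementʳ Fs if))))
               (here iy))
    where im = complement-isVertex if f≢1 iu

  walk≤2 : ∀ {e u f v} → IsVertex (e , u) → IsVertex (f , v) → ¬ (e ≡ 𝟙 × f ≡ 𝟙) →
           Σ (Walk (e , u) (f , v)) λ q → len q ≤ 2
  walk≤2 {e} {u} {f} {v} ix iy not-both-𝟙 with (e , u) ≟ⱽ (f , v)
  ... | yes refl = here ix , z≤n
  ... | no x≢y with edge? e u f v
  ...   | yes c  = edgeWalk (edge ix iy x≢y c) , s≤s z≤n
  ...   | no ¬c with ≟-Ring Fs e 𝟙
  ...     | no e≢1   = walk-via-complementˡ ix iy e≢1 (¬c ∘ inj₁) , ≤-refl
  ...     | yes refl = walk-via-complementʳ ix iy (not-both-𝟙 ∘ (refl ,_)) (¬c ∘ inj₁) , ≤-refl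

  module _ {g₀} (ig₀ : IsIdempotent Fs g₀) (g₀≢0 : g₀ ≢ 𝟘) (g₀≢1 : g₀ ≢ 𝟙) where

    -- (𝟙 , u) — (g₀ , u) — (complement g₀ , v) — (𝟙 , v)
    walk-via-proper : ∀ {u v} → IsVertex (𝟙 , u) → IsVertex (𝟙 , v) → u ≢ v → Walk (𝟙 , u) (𝟙 , v)
    walk-via-proper ix@(_ , _ , iu) iy@(_ , _ , iv) u≢v =
      step (edge ix i₁ (g₀≢1 ∘ sym ∘ ,-injectiveˡ) (inj₂ refl))
           (step (edge i₁ i₂ (u≢v ∘ ,-injectiveʳ) (inj₁ (mulR-complementʳ Fs ig₀)))
                 (step (edge i₂ iy (g₀≢0 ∘ complement≡oneR⇒≡zeroR Fs ∘ ,-injectiveˡ) (inj₂ refl))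
                       (here iy)))
      where
      i₁ = ig₀ , g₀≢0 , iu
      i₂ = complement-isVertex ig₀ g₀≢1 iv

    shortestWalk : ∀ {x y} → IsVertex x → IsVertex y → Σ (Walk x y) Shortest
    shortestWalk {e , u} {f , v} ix iy with (e , u) ≟ⱽ (f , v)
    ... | yes refl = here ix , λ _ → z≤n
    ... | no x≢y with edge? e u f v
    ...   | yes c  = edgeWalk (edge ix iy x≢y c) , 1≤len x≢y
    ...   | no ¬c with ≟-Ring Fs e 𝟙 ×-dec ≟-Ring Fs f 𝟙
    ...     | yes (refl , refl) =
                walk-via-proper ix iy (¬c ∘ inj₂) ,
                3≤len x≢y (¬c ∘ edge⁻) λ a b →
                  ¬c (inj₂ (trans (neighbour-of-𝟙 a) (sym (neighbour-of-𝟙 (adjacent-sym b)))))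
    ...     | no not-both-𝟙 =
                let p , p≤2 = walk≤2 ix iy not-both-𝟙
                in p , λ q → ≤-trans p≤2 (2≤len x≢y (¬c ∘ edge⁻) q)

  block-maximallyDistant : ∀ {e u v} → IsVertex (e , u) → IsVertex (e , v) → u ≢ v →
                           MaximallyDistant (e , u) (e , v)
  block-maximallyDistant {e} {u} {v} ix@(ie , e≢0 , _) iy u≢v =
    2 , 2≤len (u≢v ∘ ,-injectiveʳ) (Sum.[ square≢𝟘 ie e≢0 , u≢v ]′ ∘ edge⁻) , near
    where
    near : ∀ {z} → Adjacent (e , v) z → Σ (Walk (e , u) z) λ q → len q ≤ 2
    near {g , w} a = walk≤2 ix (proj₁ (proj₂ a)) not-both-𝟙
      where
      not-both-𝟙 : ¬ (e ≡ 𝟙 × g ≡ 𝟙)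
      not-both-𝟙 (refl , refl) = proj₁ (proj₂ (proj₂ a)) (cong (𝟙 ,_) (neighbour-of-𝟙 a))

  nonzeroIdempotents nonOneUnits : List (Ring Fs)
  nonzeroIdempotents = without (≟-Ring Fs) 𝟘 (idempotents Fs)
  nonOneUnits        = without (≟-Ring Fs) 𝟙 (units Fs)

  ∈-nonzeroIdempotents⁺ : ∀ {e} → IsIdempotent Fs e → e ≢ 𝟘 → e ∈ nonzeroIdempotents
  ∈-nonzeroIdempotents⁺ ie = ∈-without⁺ (≟-Ring Fs) (∈-idempotents⁺ Fs ie)

  ∈-nonzeroIdempotents⁻ : ∀ {e} → e ∈ nonzeroIdempotents → IsIdempotent Fs e × e ≢ 𝟘
  ∈-nonzeroIdempotents⁻ = Product.map₁ (∈-idempotents⁻ Fs) ∘ ∈-without⁻ (≟-Ring Fs) (idempotents Fs)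

  ∈-nonOneUnits⁺ : ∀ {u} → IsUnit Fs u → u ≢ 𝟙 → u ∈ nonOneUnits
  ∈-nonOneUnits⁺ iu = ∈-without⁺ (≟-Ring Fs) (∈-units⁺ Fs iu)

  ∈-nonOneUnits⁻ : ∀ {u} → u ∈ nonOneUnits → IsUnit Fs u × u ≢ 𝟙
  ∈-nonOneUnits⁻ = Product.map₁ (∈-units⁻ Fs) ∘ ∈-without⁻ (≟-Ring Fs) (units Fs)

  Unique-nonzeroIdempotents : Unique nonzeroIdempotents
  Unique-nonzeroIdempotents = Unique-without (≟-Ring Fs) (Unique-idempotents Fs)

  2^length≡suc[length-nonzeroIdempotents] : 2 ^ length Fs ≡ suc (length nonzeroIdempotents)
  2^length≡suc[length-nonzeroIdempotents] =
    trans (sym (length-idempotents Fs))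
          (length-without (≟-Ring Fs) (Unique-idempotents Fs) (∈-idempotents⁺ Fs (mulR-zeroʳ Fs 𝟘)))

  length-units≡suc : length (units Fs) ≡ suc (length nonOneUnits)
  length-units≡suc = length-without (≟-Ring Fs) (Unique-units Fs) (∈-units⁺ Fs (oneR-isUnit Fs))

  sdim-trivialUnits : 𝟙 ≢ 𝟘 → (∀ {u} → IsUnit Fs u → u ≡ 𝟙) →
                      IsSdim (length nonzeroIdempotents ∸ 1)
  sdim-trivialUnits 𝟙≢𝟘 trivial =
    subst (λ n → IsSdim (n ∸ 1)) (length-map (_, 𝟙) nonzeroIdempotents)
      (complete⇒IsSdim _≟ⱽ_ (Unique.map⁺ ,-injectiveˡ Unique-nonzeroIdempotents) (All.tabulate isVertex)
                       enumerates (∈-map⁺ (_, 𝟙) (∈-nonzeroIdempotents⁺ (mulR-identityˡ Fs 𝟙) 𝟙≢𝟘)) complete)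
    where
    isVertex : ∀ {x} → x ∈ map (_, 𝟙) nonzeroIdempotents → IsVertex x
    isVertex x∈ with e , e∈ , refl ← ∈-map⁻ (_, 𝟙) x∈ =
      let ie , e≢0 = ∈-nonzeroIdempotents⁻ e∈ in ie , e≢0 , oneR-isUnit Fs
    enumerates : ∀ {x} → IsVertex x → x ∈ map (_, 𝟙) nonzeroIdempotents
    enumerates (ie , e≢0 , iu) with refl ← trivial iu = ∈-map⁺ (_, 𝟙) (∈-nonzeroIdempotents⁺ ie e≢0)
    complete : ∀ {x y} → IsVertex x → IsVertex y → x ≢ y → Adjacent x y
    complete ix iy x≢y =
      edge ix iy x≢y (inj₂ (trans (trivial (proj₂ (proj₂ ix))) (sym (trivial (proj₂ (proj₂ iy))))))

  length-nonzeroIdempotents*length-nonOneUnits :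
    𝟙 ≢ 𝟘 → ∀ {v} → IsUnit Fs v → v ≢ 𝟙 →
    length nonzeroIdempotents * length nonOneUnits ≡
    (2 ^ length Fs ∸ 1) * product (map (λ F → card F ∸ 1) Fs) ∸ 2 ^ length Fs + 1
  length-nonzeroIdempotents*length-nonOneUnits 𝟙≢𝟘 iv v≢1 =
    trans (m*n≡m*[1+n]∸[1+m]+1 _ _ (∈-length (∈-nonzeroIdempotents⁺ (mulR-identityˡ Fs 𝟙) 𝟙≢𝟘))
                                   (∈-length (∈-nonOneUnits⁺ iv v≢1)))
          (cong₂ (λ t p → (t ∸ 1) * p ∸ t + 1) (sym 2^length≡suc[length-nonzeroIdempotents])
                 (trans (sym length-units≡suc) (length-units Fs)))

  module _ {g₀} (ig₀ : IsIdempotent Fs g₀) (g₀≢0 : g₀ ≢ 𝟘) (g₀≢1 : g₀ ≢ 𝟙)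
           {v₁} (iv₁ : IsUnit Fs v₁) (v₁≢1 : v₁ ≢ 𝟙) where

    open DecMembership _≟ⱽ_ using (_∈?_)

    separated-onShortest : ∀ {e f g} → IsVertex (e , 𝟙) → IsVertex (f , 𝟙) → e ≢ f →
                           Separates Fs e f g → OnShortest (f , 𝟙) (g , v₁) (e , 𝟙)
    separated-onShortest ix iy e≢f (ig , g≢0 , eg≡0 , fg≢0) =
      step (edge iy ix (e≢f ∘ sym ∘ ,-injectiveˡ) (inj₂ refl))
           (step (edge ix iw (v₁≢1 ∘ sym ∘ ,-injectiveʳ) (inj₁ eg≡0)) (here iw)) ,
      2≤len (v₁≢1 ∘ sym ∘ ,-injectiveʳ) (Sum.[ fg≢0 , v₁≢1 ∘ sym ]′ ∘ edge⁻) ,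
      there (here refl)
      where iw = ig , g≢0 , iv₁

    resolvingSet : List Vertex
    resolvingSet = cartesianProduct nonzeroIdempotents nonOneUnits

    ∈-resolvingSet : ∀ {e u} → IsVertex (e , u) → u ≢ 𝟙 → (e , u) ∈ resolvingSet
    ∈-resolvingSet (ie , e≢0 , iu) u≢1 =
      ∈-cartesianProduct⁺ (∈-nonzeroIdempotents⁺ ie e≢0) (∈-nonOneUnits⁺ iu u≢1)

    resolvingSet-isStrongResolvingSet : StrongResolvingSet resolvingSet
    resolvingSet-isStrongResolvingSet = All.tabulate isVertex , resolve
      where
      isVertex : ∀ {x} → x ∈ resolvingSet → IsVertex x
      isVertex x∈ =
        let e∈ , u∈ = ∈-cartesianProduct⁻ nonzeroIdempotents nonOneUnits x∈
            ie , e≢0 = ∈-nonzeroIdempotents⁻ e∈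
        in ie , e≢0 , proj₁ (∈-nonOneUnits⁻ u∈)
      onShortest : ∀ {x y} → IsVertex x → IsVertex y → OnShortest x y y
      onShortest ix iy =
        let p , p-shortest = shortestWalk ig₀ g₀≢0 g₀≢1 ix iy in shortest⇒onShortest p p-shortest
      resolve : ∀ x y → IsVertex x → IsVertex y → x ≢ y →
                Σ Vertex λ w → w ∈ resolvingSet × StronglyResolves w x y
      resolve (e , u) (f , v) ix iy x≢y with ≟-Ring Fs u 𝟙 | ≟-Ring Fs v 𝟙
      ... | no u≢1   | _        = (e , u) , ∈-resolvingSet ix u≢1 , inj₂ (onShortest iy ix)
      ... | yes _    | no v≢1   = (f , v) , ∈-resolvingSet iy v≢1 , inj₁ (onShortest ix iy)
      ... | yes refl | yes refl with separate Fs (proj₁ ix) (proj₁ iy) (x≢y ∘ cong (_, 𝟙))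
      ...   | inj₁ (g , ig , g≢0 , sep) =
                (g , v₁) , ∈-resolvingSet (ig , g≢0 , iv₁) v₁≢1 ,
                inj₂ (separated-onShortest ix iy (x≢y ∘ cong (_, 𝟙)) (ig , g≢0 , sep))
      ...   | inj₂ (g , ig , g≢0 , sep) =
                (g , v₁) , ∈-resolvingSet (ig , g≢0 , iv₁) v₁≢1 ,
                inj₁ (separated-onShortest iy ix (x≢y ∘ cong (_, 𝟙) ∘ sym) (ig , g≢0 , sep))

    strongResolvingSet⇒length≥ : ∀ {S} → StrongResolvingSet S →
                                 length nonzeroIdempotents * length nonOneUnits ≤ length S
    strongResolvingSet⇒length≥ {S} srs = begin
        length E * length nonOneUnits
      ≡⟨ cong (λ n → length E * (n ∸ 1)) length-units≡suc ⟨
        length E * (length U ∸ 1)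
      ≤⟨ length-filter-cartesianProduct≥ (_∈? S) E U row ⟩
        length (filter (_∈? S) (cartesianProduct E U))
      ≤⟨ Unique⇒length-filter-∈≤ _≟ⱽ_ S (Unique.cartesianProduct⁺ Unique-nonzeroIdempotents (Unique-units Fs)) ⟩
        length S
      ∎
      where
      open ≤-Reasoning
      E = nonzeroIdempotents
      U = units Fs
      row : ∀ {e} → e ∈ E → length U ∸ 1 ≤ length (filter (_∈? S) (map (e ,_) U))
      row {e} e∈ =
        subst (λ n → n ∸ 1 ≤ length (filter (_∈? S) (map (e ,_) U))) (length-map (e ,_) U)
              (pairwise-mmd⇒length∸1≤ _≟ⱽ_ srs (Unique.map⁺ ,-injectiveʳ (Unique-units Fs)) (All.tabulate isVertex) mmd)
        where
        isVertex : ∀ {x} → x ∈ map (e ,_) U → IsVertex x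
        isVertex x∈ with u , u∈ , refl ← ∈-map⁻ (e ,_) x∈ =
          let ie , e≢0 = ∈-nonzeroIdempotents⁻ e∈ in ie , e≢0 , ∈-units⁻ Fs u∈
        mmd : ∀ {x y} → x ∈ map (e ,_) U → y ∈ map (e ,_) U → x ≢ y → MutuallyMaximallyDistant x y
        mmd x∈ y∈ x≢y with u , _ , refl ← ∈-map⁻ (e ,_) x∈ | v , _ , refl ← ∈-map⁻ (e ,_) y∈ =
          block-maximallyDistant (isVertex x∈) (isVertex y∈) (x≢y ∘ cong (e ,_)) ,
          block-maximallyDistant (isVertex y∈) (isVertex x∈) (x≢y ∘ cong (e ,_) ∘ sym)

    sdim-nontrivialUnits : IsSdim (length nonzeroIdempotents * length nonOneUnits)
    sdim-nontrivialUnits =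
      (resolvingSet , resolvingSet-isStrongResolvingSet ,
       Unique.cartesianProduct⁺ Unique-nonzeroIdempotents (Unique-without (≟-Ring Fs) (Unique-units Fs)) ,
       length-cartesianProduct nonzeroIdempotents nonOneUnits) ,
      λ _ → strongResolvingSet⇒length≥

corollary4p10 : (Fs : List Fld) → 2 ≤ length Fs →
  ((All (_≡ ℤ₂) Fs → SdimCl₂ Fs (2 ^ length Fs ∸ 2)) ×
   (Any (_≡ ℤ₃) Fs →
     SdimCl₂ Fs ((2 ^ length Fs ∸ 1) * product (map (λ F → card F ∸ 1) Fs) ∸ 2 ^ length Fs + 1)))
corollary4p10 Fs@(F ∷ F′ ∷ Fs′) (s≤s (s≤s z≤n)) = part-i , part-ii
  where
  open Cl₂Geometry Fs
  𝟙≢𝟘 : oneR Fs ≢ zeroR Fs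
  𝟙≢𝟘 = zeroF≢oneF F ∘ sym ∘ ,-injectiveˡ
  part-i : All (_≡ ℤ₂) Fs → SdimCl₂ Fs (2 ^ length Fs ∸ 2)
  part-i all-ℤ₂ =
    subst (SdimCl₂ Fs) (cong (_∸ 2) (sym 2^length≡suc[length-nonzeroIdempotents]))
          (sdim-trivialUnits 𝟙≢𝟘 (all-ℤ₂⇒unit≡oneR Fs all-ℤ₂))
  part-ii : Any (_≡ ℤ₃) Fs →
            SdimCl₂ Fs ((2 ^ length Fs ∸ 1) * product (map (λ F → card F ∸ 1) Fs) ∸ 2 ^ length Fs + 1)
  part-ii has-ℤ₃ =
    let _ , ig₀ , g₀≢0 , g₀≢1 = properIdempotent F F′ Fs′
        _ , iv₁ , v₁≢1 = nontrivialUnit Fs has-ℤ₃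
    in subst (SdimCl₂ Fs) (length-nonzeroIdempotents*length-nonOneUnits 𝟙≢𝟘 iv₁ v₁≢1)
             (sdim-nontrivialUnits ig₀ g₀≢0 g₀≢1 iv₁ v₁≢1)
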